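{- Let $p$ be a prime with $p\equiv1\pmod4$, let $u_p=(t+b\sqrt p)/2>1$ ($t,b$ positive integers) be the fundamental unit of $\mathbb Q(\sqrt p)$, and let $A,B$ be integers with $p=A^2+B^2$ and $A\equiv-1\pmod4$. Then exactly one of $p\mid At+2B$ and $p\mid At-2B$ holds. -}

module Defs where

open import Data.Nat using (ℕ)
open import Data.Integer using (ℤ; +_; -_; _+_; _-_; _*_; _<_; _≤_)
open import Data.Integer.Divisibility using (_∣_)
open import Data.Product using (_×_; Σ)
open import Data.Sum using (_⊎_)
open import Relation.Binary.PropositionalEquality using (_≡_)

-- Elements of Q(√p) are written (t + b√p)/2 with t b : ℤ.
-- PosSqrt d x y : the real number x + y√d is strictly positive (d > 0 not a square).
PosSqrt : ℤ → ℤ → ℤ → Set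
PosSqrt d x y =
    ((+ 0 < x) × (+ 0 ≤ y))
  ⊎ ((+ 0 ≤ x) × (+ 0 < y))
  ⊎ ((+ 0 < x) × (y < + 0) × (d * y * y < x * x))
  ⊎ ((x < + 0) × (+ 0 < y) × (x * x < d * y * y))

NonNegSqrt : ℤ → ℤ → ℤ → Set
NonNegSqrt d x y = PosSqrt d x y ⊎ ((x ≡ + 0) × (y ≡ + 0))

-- (t + b√d)/2 is a unit of the ring of integers of Q(√d), d ≡ 1 (mod 4):
-- it is an algebraic integer (t ≡ b mod 2) and has norm (t² - d b²)/4 = ±1.
IsUnit : ℤ → ℤ → ℤ → Set
IsUnit d t b =
  ((t * t - d * b * b ≡ + 4) ⊎ (t * t - d * b * b ≡ - (+ 4))) × (+ 2 ∣ (t - b))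

-- (t + b√d)/2 > 1, i.e. (t - 2) + b√d > 0
GtOne : ℤ → ℤ → ℤ → Set
GtOne d t b = PosSqrt d (t - + 2) b

IsFundamentalUnit : ℤ → ℤ → ℤ → Set
IsFundamentalUnit d t b =
  IsUnit d t b × GtOne d t b ×
  ((t' b' : ℤ) → IsUnit d t' b' → GtOne d t' b' → NonNegSqrt d (t' - t) (b' - b))

-- The fundamental unit (t + b√p)/2 has norm -1. Otherwise t² - p b² = 4, i.e. (t - 2)(t + 2) = p b²;
-- the gcd of the two factors divides 4, and a case analysis modulo 4 (which uses p ≡ 1 mod 4) shows
-- that {t - 2, t + 2} = {s², p r²} with b = s r. Then (s + r√p)/2 is a unit whose square is the
-- fundamental unit, contradicting minimality.
-- Given t² - p b² = -4 and p = A² + B², one has (A t + 2B)(A t - 2B) = p (A² b² - 4), so p divides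
-- one of the factors. It cannot divide both: then p ∣ 4B, so p ∣ B, p ∣ A and p² ∣ A² + B² = p.
module Submission where

module SquareFactorisation where
  open import Data.Nat
  open import Data.Nat.Properties
  open import Data.Nat.Divisibility
  open import Data.Nat.DivMod using (m/n*n≡m)
  open import Data.Nat.Coprimality as Coprime using (Coprime; coprime-divisor; coprime-/gcd)
  open import Data.Nat.GCD using (gcd; gcd[m,n]∣m; gcd[m,n]∣n; gcd[m,n]≢0)
  open import Data.Nat.Primality using (Prime; euclidsLemma; prime⇒nonZero)
  open import Data.Nat.Tactic.RingSolver using (solve)
  open import Data.List.Base using ([]; _∷_)
  open import Data.Product as Product using (∃; ∃₂; _×_; _,_) renaming (swap to ×-swap)
  open import Data.Sum as Sum using (_⊎_; inj₁; inj₂) renaming (swap to ⊎-swap)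
  open import Relation.Binary.Definitions using (tri<; tri≈; tri>)
  open import Relation.Binary.PropositionalEquality
  open import Relation.Nullary.Negation using (contradiction)

  m*m≡n*n⇒m≡n : ∀ {m n} → m * m ≡ n * n → m ≡ n
  m*m≡n*n⇒m≡n {m} {n} eq with <-cmp m n
  ... | tri< m<n _ _ = contradiction eq (<⇒≢ (*-mono-< m<n m<n))
  ... | tri≈ _ m≡n _ = m≡n
  ... | tri> _ _ n<m = contradiction (sym eq) (<⇒≢ (*-mono-< n<m n<m))

  coprime-∣ˡ : ∀ {d m n} → d ∣ m → Coprime m n → Coprime d n
  coprime-∣ˡ d∣m m⊥n (i∣d , i∣n) = m⊥n (∣-trans i∣d d∣m , i∣n)

  coprime-squareʳ : ∀ {m n} → Coprime m n → Coprime m (n * n)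
  coprime-squareʳ m⊥n (i∣m , i∣nn) = m⊥n (i∣m , coprime-divisor (coprime-∣ˡ i∣m m⊥n) i∣nn)

  -- Cancelling g gives a' b = g k'², so a' ∣ g (a' ⊥ k'²) and g ∣ a' (g ∣ a' g, which is ⊥ b).
  [a'g]b≡[k'g]²⇒a'≡g : ∀ {a' b k' g} .{{_ : NonZero g}} → Coprime a' k' → Coprime (a' * g) b →
                       (a' * g) * b ≡ (k' * g) * (k' * g) → a' ≡ g
  [a'g]b≡[k'g]²⇒a'≡g {a'} {b} {k'} {g} a'⊥k' a'g⊥b eq = ∣-antisym a'∣g g∣a'
    where
    open ≡-Reasoning
    a'b≡gk'k' : a' * b ≡ g * (k' * k')
    a'b≡gk'k' = *-cancelˡ-≡ _ _ g (begin
      g * (a' * b)         ≡⟨ solve (g ∷ a' ∷ b ∷ []) ⟩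
      (a' * g) * b         ≡⟨ eq ⟩
      (k' * g) * (k' * g)  ≡⟨ solve (g ∷ k' ∷ []) ⟩
      g * (g * (k' * k'))  ∎)
    a'∣g : a' ∣ g
    a'∣g = coprime-divisor (coprime-squareʳ a'⊥k')
             (divides b (trans (*-comm (k' * k') g) (trans (sym a'b≡gk'k') (*-comm a' b))))
    g∣a' : g ∣ a'
    g∣a' = coprime-divisor (coprime-∣ˡ (n∣m*n a') a'g⊥b)
             (divides (k' * k') (trans (*-comm b a') (trans a'b≡gk'k' (*-comm g (k' * k')))))

  coprime-*≡square⇒square : ∀ {a b k} → Coprime a b → a * b ≡ k * k → ∃ λ s → a ≡ s * s
  coprime-*≡square⇒square {zero} _ _ = 0 , refl
  coprime-*≡square⇒square {a@(suc _)} {b} {k} a⊥b ab≡kk = g , (begin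
      a      ≡⟨ a'g≡a ⟨
      a' * g ≡⟨ cong (_* g) ([a'g]b≡[k'g]²⇒a'≡g (coprime-/gcd a k) a'g⊥b eq) ⟩
      g * g  ∎)
    where
    open ≡-Reasoning
    g = gcd a k
    instance
      g≢0 : NonZero g
      g≢0 = ≢-nonZero (gcd[m,n]≢0 a k (inj₁ λ ()))
    a' = a / g
    k' = k / g
    a'g≡a : a' * g ≡ a
    a'g≡a = m/n*n≡m (gcd[m,n]∣m a k)
    k'g≡k : k' * g ≡ k
    k'g≡k = m/n*n≡m (gcd[m,n]∣n a k)
    a'g⊥b : Coprime (a' * g) b
    a'g⊥b = subst (λ x → Coprime x b) (sym a'g≡a) a⊥b
    eq : (a' * g) * b ≡ (k' * g) * (k' * g)
    eq = trans (cong (_* b) a'g≡a) (trans ab≡kk (sym (cong₂ _*_ k'g≡k k'g≡k)))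

  coprime-*≡square : ∀ {a b k} → Coprime a b → a * b ≡ k * k →
                     ∃₂ λ s r → a ≡ s * s × b ≡ r * r × k ≡ s * r
  coprime-*≡square {a} {b} {k} a⊥b ab≡kk
    with coprime-*≡square⇒square {k = k} a⊥b ab≡kk
       | coprime-*≡square⇒square {k = k} (Coprime.sym a⊥b) (trans (*-comm b a) ab≡kk)
  ... | s , a≡ss | r , b≡rr = s , r , a≡ss , b≡rr , m*m≡n*n⇒m≡n (begin
    k * k              ≡⟨ ab≡kk ⟨
    a * b              ≡⟨ cong₂ _*_ a≡ss b≡rr ⟩
    (s * s) * (r * r)  ≡⟨ solve (s ∷ r ∷ []) ⟩
    (s * r) * (s * r)  ∎)
    where open ≡-Reasoning

  record PrimeSquareSplit (p m n k : ℕ) : Set where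
    field
      s r     : ℕ
      k≡s*r   : k ≡ s * r
      squares : (m ≡ s * s × n ≡ p * (r * r)) ⊎ (m ≡ p * (r * r) × n ≡ s * s)

  PrimeSquareSplit-sym : ∀ {p m n k} → PrimeSquareSplit p m n k → PrimeSquareSplit p n m k
  PrimeSquareSplit-sym record { s = s ; r = r ; k≡s*r = k≡s*r ; squares = squares } =
    record { s = s ; r = r ; k≡s*r = k≡s*r ; squares = ⊎-swap (Sum.map ×-swap ×-swap squares) }

  PrimeSquareSplit-cong : ∀ {p m m' n n' k k'} → m ≡ m' → n ≡ n' → k ≡ k' →
                          PrimeSquareSplit p m n k → PrimeSquareSplit p m' n' k'
  PrimeSquareSplit-cong refl refl refl split = split

  PrimeSquareSplit-scale : ∀ {p m n k} c → PrimeSquareSplit p m n k →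
                           PrimeSquareSplit p (c * c * m) (c * c * n) (c * c * k)
  PrimeSquareSplit-scale {p} c record { s = s ; r = r ; k≡s*r = k≡s*r ; squares = squares } = record
    { s = c * s ; r = c * r
    ; k≡s*r = trans (cong (c * c *_) k≡s*r) (solve (c ∷ s ∷ r ∷ []))
    ; squares = Sum.map (Product.map scale-square scale-p*square) (Product.map scale-p*square scale-square) squares
    }
    where
    scale-square : ∀ {x} → x ≡ s * s → c * c * x ≡ c * s * (c * s)
    scale-square refl = solve (c ∷ s ∷ [])
    scale-p*square : ∀ {x} → x ≡ p * (r * r) → c * c * x ≡ p * (c * r * (c * r))
    scale-p*square refl = solve (p ∷ c ∷ r ∷ [])

  private
    prime∣m⇒split : ∀ {p m n k} → Prime p → Coprime m n → m * n ≡ p * (k * k) → p ∣ m →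
                    PrimeSquareSplit p m n k
    prime∣m⇒split {p} {m} {n} {k} pr m⊥n mn≡pkk (divides m' m≡m'p) =
      from-squares (coprime-*≡square (coprime-∣ˡ (divides p (trans m≡m'p (*-comm m' p))) m⊥n) m'n≡kk)
      where
      open ≡-Reasoning
      instance _ = prime⇒nonZero pr
      m'n≡kk : m' * n ≡ k * k
      m'n≡kk = *-cancelˡ-≡ _ _ p (begin
        p * (m' * n)  ≡⟨ *-assoc p m' n ⟨
        p * m' * n    ≡⟨ cong (_* n) (trans (*-comm p m') (sym m≡m'p)) ⟩
        m * n         ≡⟨ mn≡pkk ⟩
        p * (k * k)   ∎)
      from-squares : (∃₂ λ r s → m' ≡ r * r × n ≡ s * s × k ≡ r * s) → PrimeSquareSplit p m n k
      from-squares (r , s , m'≡rr , n≡ss , k≡rs) = record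
        { s = s ; r = r ; k≡s*r = trans k≡rs (*-comm r s)
        ; squares = inj₂ (trans m≡m'p (trans (cong (_* p) m'≡rr) (*-comm (r * r) p)) , n≡ss)
        }

  coprime-*≡prime*square : ∀ {p m n k} → Prime p → Coprime m n → m * n ≡ p * (k * k) →
                           PrimeSquareSplit p m n k
  coprime-*≡prime*square {p} {m} {n} {k} pr m⊥n mn≡pkk
    with euclidsLemma m n pr (divides (k * k) (trans mn≡pkk (*-comm p (k * k))))
  ... | inj₁ p∣m = prime∣m⇒split pr m⊥n mn≡pkk p∣m
  ... | inj₂ p∣n = PrimeSquareSplit-sym (prime∣m⇒split pr (Coprime.sym m⊥n) (trans (*-comm n m) mn≡pkk) p∣n)

module Parity where
  open import Data.Nat
  open import Data.Nat.Properties
  open import Data.Nat.Divisibility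
  open import Data.Nat.DivMod using (_%_; [m+kn]%n≡m%n)
  open import Data.Nat.Coprimality using (Coprime)
  open import Data.Nat.Primality using (euclidsLemma; prime[2])
  open import Data.Nat.Tactic.RingSolver using (solve-∀; solve)
  open import Data.List.Base using ([]; _∷_)
  open import Data.Product using (∃; _×_; _,_)
  open import Data.Sum using (_⊎_; inj₁; inj₂; [_,_]′)
  open import Function using (id; _∘′_)
  open import Relation.Binary.PropositionalEquality
  open import Relation.Nullary using (¬_)
  open import Relation.Nullary.Decidable using (from-no)
  open import Relation.Nullary.Negation using (contradiction)

  even⊎odd : ∀ n → ∃ λ k → n ≡ 2 * k ⊎ n ≡ 1 + 2 * k
  even⊎odd zero = 0 , inj₁ refl
  even⊎odd (suc n) with even⊎odd n
  ... | k , inj₁ n≡2k   = k , inj₂ (cong suc n≡2k)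
  ... | k , inj₂ n≡1+2k = suc k , inj₁ (cong suc (trans n≡1+2k (sym (+-suc k (k + 0)))))

  2∤1+2* : ∀ k → ¬ 2 ∣ 1 + 2 * k
  2∤1+2* k (divides q 1+2k≡q2) = even≢odd q k (sym (trans 1+2k≡q2 (*-comm q 2)))

  2∣n*n⇒2∣n : ∀ {n} → 2 ∣ n * n → 2 ∣ n
  2∣n*n⇒2∣n {n} 2∣nn = [ id , id ]′ (euclidsLemma n n prime[2] 2∣nn)

  2∣m*m+n*n⇒2∣m+n : ∀ {m n} → 2 ∣ m * m + n * n → 2 ∣ m + n
  2∣m*m+n*n⇒2∣m+n {m} {n} 2∣mm+nn =
    2∣n*n⇒2∣n (subst (2 ∣_) (identity m n) (∣m∣n⇒∣m+n 2∣mm+nn (n∣m*n (m * n))))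
    where
    identity : ∀ m n → (m * m + n * n) + m * n * 2 ≡ (m + n) * (m + n)
    identity = solve-∀

  coprime-4-odd : ∀ k → Coprime 4 (1 + 2 * k)
  coprime-4-odd k {0} (0∣4 , _) = contradiction 0∣4 (from-no (0 ∣? 4))
  coprime-4-odd k {1} _ = refl
  coprime-4-odd k {2} (_ , 2∣odd) = contradiction 2∣odd (2∤1+2* k)
  coprime-4-odd k {3} (3∣4 , _) = contradiction 3∣4 (from-no (3 ∣? 4))
  coprime-4-odd k {4} (_ , 4∣odd) = contradiction (∣-trans (divides 2 refl) 4∣odd) (2∤1+2* k)
  coprime-4-odd k {suc (suc (suc (suc (suc i))))} (i∣4 , _) =
    contradiction (∣⇒≤ i∣4) λ { (s≤s (s≤s (s≤s (s≤s ())))) }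

  4*m≡p*n*n⇒n≡2*n' : ∀ {p m n} → ¬ 2 ∣ p → 4 * m ≡ p * (n * n) →
                     ∃ λ n' → n ≡ 2 * n' × m ≡ p * (n' * n')
  4*m≡p*n*n⇒n≡2*n' {p} {m} {n} 2∤p 4m≡pnn = halve (2∣n*n⇒2∣n 2∣nn)
    where
    2∣nn : 2 ∣ n * n
    2∣nn with euclidsLemma p (n * n) prime[2]
                (divides (m * 2) (trans (sym 4m≡pnn) (trans (*-comm 4 m) (sym (*-assoc m 2 2)))))
    ... | inj₁ 2∣p  = contradiction 2∣p 2∤p
    ... | inj₂ 2∣nn = 2∣nn
    halve : 2 ∣ n → ∃ λ n' → n ≡ 2 * n' × m ≡ p * (n' * n')
    halve (divides n' n≡n'2) = n' , trans n≡n'2 (*-comm n' 2) , *-cancelˡ-≡ m (p * (n' * n')) 4 (begin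
      4 * m                    ≡⟨ 4m≡pnn ⟩
      p * (n * n)              ≡⟨ cong (λ x → p * (x * x)) n≡n'2 ⟩
      p * (n' * 2 * (n' * 2))  ≡⟨ solve (p ∷ n' ∷ []) ⟩
      4 * (p * (n' * n'))      ∎)
      where open ≡-Reasoning

  p≡1+4q⇒2∤p : ∀ {p q} → p ≡ 1 + 4 * q → ¬ 2 ∣ p
  p≡1+4q⇒2∤p {q = q} p≡1+4q 2∣p =
    2∤1+2* (2 * q) (subst (2 ∣_) (trans p≡1+4q (cong suc (*-assoc 2 2 q))) 2∣p)

  x≡r+k*4⇒x%4≡r%4 : ∀ x r k → x ≡ r + k * 4 → x % 4 ≡ r % 4
  x≡r+k*4⇒x%4≡r%4 _ r k refl = [m+kn]%n≡m%n r k 4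

  n*n%4≡0⊎1 : ∀ n → n * n % 4 ≡ 0 ⊎ n * n % 4 ≡ 1
  n*n%4≡0⊎1 n with even⊎odd n
  ... | k , inj₁ refl = inj₁ (x≡r+k*4⇒x%4≡r%4 (2 * k * (2 * k)) 0 (k * k) (solve (k ∷ [])))
  ... | k , inj₂ refl = inj₂ (x≡r+k*4⇒x%4≡r%4 ((1 + 2 * k) * (1 + 2 * k)) 1 (k * k + k) (solve (k ∷ [])))

  odd*[odd+2]≢[1+4q]*square : ∀ q z n → (1 + 2 * z) * (1 + 2 * z + 2) ≢ (1 + 4 * q) * (n * n)
  odd*[odd+2]≢[1+4q]*square q z n eq =
    [ (λ ()) ∘′ trans 3≡nn%4 , (λ ()) ∘′ trans 3≡nn%4 ]′ (n*n%4≡0⊎1 n)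
    where
    open ≡-Reasoning
    3≡nn%4 : 3 ≡ n * n % 4
    3≡nn%4 = begin
      3
        ≡⟨ x≡r+k*4⇒x%4≡r%4 ((1 + 2 * z) * (1 + 2 * z + 2)) 3 (z * z + 2 * z) (solve (z ∷ [])) ⟨
      (1 + 2 * z) * (1 + 2 * z + 2) % 4
        ≡⟨ cong (_% 4) eq ⟩
      (1 + 4 * q) * (n * n) % 4
        ≡⟨ x≡r+k*4⇒x%4≡r%4 ((1 + 4 * q) * (n * n)) (n * n) (q * (n * n)) (solve (q ∷ n ∷ [])) ⟩
      n * n % 4
        ∎

module Descent where
  open import Data.Nat
  open import Data.Nat.Properties
  open import Data.Nat.Divisibility
  open import Data.Nat.Coprimality as Coprime using (Coprime; coprime-+; 1-coprimeTo)
  open import Data.Nat.Primality using (Prime; prime⇒nonZero)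
  open import Data.Nat.Tactic.RingSolver using (solve-∀; solve)
  open import Data.List.Base using ([]; _∷_)
  open import Data.Product using (_×_; _,_)
  open import Data.Sum using (_⊎_; inj₁; inj₂)
  open import Function using (it)
  open import Relation.Binary.PropositionalEquality
  open import Relation.Nullary.Negation using (contradiction)
  open SquareFactorisation
  open Parity

  coprime-+1 : ∀ n → Coprime n (n + 1)
  coprime-+1 n = Coprime.sym (coprime-+ (1-coprimeTo n))

  coprime-odd-+4 : ∀ k → Coprime (1 + 2 * k) (1 + 2 * k + 4)
  coprime-odd-+4 k = Coprime.sym (coprime-+ (coprime-4-odd k))

  4l*[4l+4]≡p*B*B⇒split : ∀ {p q l B} → Prime p → p ≡ 1 + 4 * q → 4 * l * (4 * l + 4) ≡ p * (B * B) →
                          PrimeSquareSplit p (4 * l) (4 * l + 4) B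
  4l*[4l+4]≡p*B*B⇒split {p} {q} {l} {B} pr p≡1+4q 4l[4l+4]≡pBB =
    let C , B≡2C , 4l[l+1]≡pCC = 4*m≡p*n*n⇒n≡2*n' 2∤p (trans (identity l) 4l[4l+4]≡pBB)
        k , C≡2k , l[l+1]≡pkk  = 4*m≡p*n*n⇒n≡2*n' {n = C} 2∤p 4l[l+1]≡pCC
        B≡4k = trans B≡2C (trans (cong (2 *_) C≡2k) (sym (*-assoc 2 2 k)))
    in PrimeSquareSplit-cong refl (*-distribˡ-+ 4 l 1) (sym B≡4k)
         (PrimeSquareSplit-scale 2 (coprime-*≡prime*square {k = k} pr (coprime-+1 l) l[l+1]≡pkk))
    where
    2∤p = p≡1+4q⇒2∤p {q = q} p≡1+4q
    identity : ∀ l → 4 * (4 * (l * (l + 1))) ≡ 4 * l * (4 * l + 4)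
    identity = solve-∀

  [2+4z]*[2+4z+4]≢p*B*B : ∀ {p q z B} → p ≡ 1 + 4 * q → (2 + 4 * z) * (2 + 4 * z + 4) ≢ p * (B * B)
  [2+4z]*[2+4z+4]≢p*B*B {p} {q} {z} {B} p≡1+4q eq =
    let C , _ , [1+2z][3+2z]≡pCC =
          4*m≡p*n*n⇒n≡2*n' {n = B} (p≡1+4q⇒2∤p {q = q} p≡1+4q) (trans (identity z) eq)
    in odd*[odd+2]≢[1+4q]*square q z C (trans [1+2z][3+2z]≡pCC (cong (_* (C * C)) p≡1+4q))
    where
    identity : ∀ z → 4 * ((1 + 2 * z) * (1 + 2 * z + 2)) ≡ (2 + 4 * z) * (2 + 4 * z + 4)
    identity = solve-∀

  m*[m+4]≡p*B*B⇒split : ∀ {p q m B} → Prime p → p ≡ 1 + 4 * q → m * (m + 4) ≡ p * (B * B) →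
                        PrimeSquareSplit p m (m + 4) B
  m*[m+4]≡p*B*B⇒split {p} {q} {m} {B} pr p≡1+4q eq with even⊎odd m
  ... | w , inj₂ m≡1+2w =
    coprime-*≡prime*square pr (subst (λ x → Coprime x (x + 4)) (sym m≡1+2w) (coprime-odd-+4 w)) eq
  ... | n , inj₁ m≡2n with even⊎odd n
  ... | l , inj₁ n≡2l =
    PrimeSquareSplit-cong (sym m≡4l) (cong (_+ 4) (sym m≡4l)) refl
      (4l*[4l+4]≡p*B*B⇒split {q = q} {l} pr p≡1+4q (subst (λ x → x * (x + 4) ≡ p * (B * B)) m≡4l eq))
    where
    m≡4l : m ≡ 4 * l
    m≡4l = trans m≡2n (trans (cong (2 *_) n≡2l) (sym (*-assoc 2 2 l)))
  ... | z , inj₂ n≡1+2z =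
    contradiction (subst (λ x → x * (x + 4) ≡ p * (B * B)) m≡2+4z eq)
                  ([2+4z]*[2+4z+4]≢p*B*B {q = q} {z} {B} p≡1+4q)
    where
    identity : ∀ z → 2 * (1 + 2 * z) ≡ 2 + 4 * z
    identity = solve-∀
    m≡2+4z : m ≡ 2 + 4 * z
    m≡2+4z = trans m≡2n (trans (cong (2 *_) n≡1+2z) (identity z))

  m*m<n*n⇒m<n : ∀ {m n} → m * m < n * n → m < n
  m*m<n*n⇒m<n mm<nn = ≰⇒> λ n≤m → <⇒≱ mm<nn (*-mono-≤ n≤m n≤m)

  m+4<[2+m]*[2+m] : ∀ m .{{_ : NonZero m}} → m + 4 < (2 + m) * (2 + m)
  m+4<[2+m]*[2+m] m@(suc k) = subst (m + 4 <_) (identity k) (m<m+n (m + 4) {suc (k * k + 5 * k + 3)} z<s)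
    where
    identity : ∀ k → suc k + 4 + suc (k * k + 5 * k + 3) ≡ (3 + k) * (3 + k)
    identity = solve-∀

  Norm±4 : ℕ → ℕ → ℕ → Set
  Norm±4 p S R = S * S ≡ p * (R * R) + 4 ⊎ S * S + 4 ≡ p * (R * R)

  norm±4⇒2∣S*S+R*R : ∀ {p q S R} → p ≡ 1 + 4 * q → Norm±4 p S R → 2 ∣ S * S + R * R
  norm±4⇒2∣S*S+R*R {q = q} {S} {R} refl (inj₁ SS≡pRR+4) = divides ((1 + 2 * q) * (R * R) + 2) (begin
    S * S + R * R                      ≡⟨ cong (_+ R * R) SS≡pRR+4 ⟩
    (1 + 4 * q) * (R * R) + 4 + R * R  ≡⟨ solve (q ∷ R ∷ []) ⟩
    ((1 + 2 * q) * (R * R) + 2) * 2    ∎)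
    where open ≡-Reasoning
  norm±4⇒2∣S*S+R*R {q = q} {S} {R} refl (inj₂ SS+4≡pRR) = ∣m+n∣m⇒∣n (divides ((1 + 2 * q) * (R * R)) (begin
    4 + (S * S + R * R)                ≡⟨ solve (S ∷ R ∷ []) ⟩
    S * S + 4 + R * R                  ≡⟨ cong (_+ R * R) SS+4≡pRR ⟩
    (1 + 4 * q) * (R * R) + R * R      ≡⟨ solve (q ∷ R ∷ []) ⟩
    (1 + 2 * q) * (R * R) * 2          ∎)) (divides 2 refl)
    where open ≡-Reasoning

  record SmallerUnit (p T B : ℕ) : Set where
    field
      S R   : ℕ
      norm  : Norm±4 p S R
      2∣S+R : 2 ∣ S + R
      S≢0   : NonZero S
      R≢0   : NonZero R
      S<T   : S < T
      R≤B   : R ≤ B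

  -- With T = 2 + m, the split {m, m + 4} = {S², p R²}, B = S R yields the unit (S + R√p)/2.
  norm+4⇒smaller-unit : ∀ {p q T B} {{_ : NonZero B}} → Prime p → p ≡ 1 + 4 * q →
                        T * T ≡ p * (B * B) + 4 → SmallerUnit p T B
  norm+4⇒smaller-unit {T = 0} _ _ eq = contradiction (trans eq (+-comm _ 4)) λ ()
  norm+4⇒smaller-unit {T = 1} _ _ eq = contradiction (trans eq (+-comm _ 4)) λ ()
  norm+4⇒smaller-unit {p} {T = 2} {B} pr _ eq =
    contradiction (sym (+-cancelʳ-≡ 4 0 (p * (B * B)) eq)) (≢-nonZero⁻¹ (p * (B * B)))
    where instance
      _ = prime⇒nonZero pr
      _ = m*n≢0 B B
      _ = m*n≢0 p (B * B)
  norm+4⇒smaller-unit {p} {q} {suc (suc m@(suc _))} {B} pr p≡1+4q eq =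
    from-split (m*[m+4]≡p*B*B⇒split {q = q} {B = B} pr p≡1+4q (+-cancelʳ-≡ 4 _ _ (trans (identity m) eq)))
    where
    identity : ∀ m → m * (m + 4) + 4 ≡ (2 + m) * (2 + m)
    identity = solve-∀
    from-split : PrimeSquareSplit p m (m + 4) B → SmallerUnit p (2 + m) B
    from-split record { s = s ; r = r ; k≡s*r = B≡sr ; squares = squares } = record
      { S = s ; R = r
      ; norm = norm squares
      ; 2∣S+R = 2∣m*m+n*n⇒2∣m+n {s} {r} (norm±4⇒2∣S*S+R*R {q = q} {s} {r} p≡1+4q (norm squares))
      ; S≢0 = m*n≢0⇒m≢0 s
      ; R≢0 = m*n≢0⇒n≢0 s
      ; S<T = m*m<n*n⇒m<n (≤-<-trans (ss≤m+4 squares) (m+4<[2+m]*[2+m] m))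
      ; R≤B = subst (r ≤_) (sym B≡sr) (m≤n*m r s {{m*n≢0⇒m≢0 s}})
      }
      where
      instance _ = subst NonZero B≡sr it
      Squares = (m ≡ s * s × m + 4 ≡ p * (r * r)) ⊎ (m ≡ p * (r * r) × m + 4 ≡ s * s)
      norm : Squares → Norm±4 p s r
      norm (inj₁ (m≡ss , m+4≡prr)) = inj₂ (trans (cong (_+ 4) (sym m≡ss)) m+4≡prr)
      norm (inj₂ (m≡prr , m+4≡ss)) = inj₁ (trans (sym m+4≡ss) (cong (_+ 4) m≡prr))
      ss≤m+4 : Squares → s * s ≤ m + 4
      ss≤m+4 (inj₁ (m≡ss , _)) = subst (_≤ m + 4) m≡ss (m≤m+n m 4)
      ss≤m+4 (inj₂ (_ , m+4≡ss)) = ≤-reflexive (sym m+4≡ss)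

open import Defs
open import Data.Nat using (ℕ; _%_; NonZero)
open import Data.Nat.Primality using (Prime)
open import Data.Integer using (ℤ; +_; -_; _+_; _-_; _*_; _<_)
open import Data.Integer.Divisibility using (_∣_)
open import Data.Product using (_×_)
open import Data.Sum using (_⊎_)
open import Relation.Nullary using (¬_)
open import Relation.Binary.PropositionalEquality using (_≡_)

import Data.Nat as ℕ
import Data.Nat.Properties as ℕ
import Data.Nat.Divisibility as ℕ
open import Data.Nat.DivMod using (m≡m%n+[m/n]*n)
open import Data.Nat.Primality using (euclidsLemma; prime⇒nonTrivial)
import Data.Integer as ℤ
open import Data.Integer using (_≤_; +≤+; +<+; -<+)
open import Data.Integer.Properties
  using (+-injective; +-comm; pos-+; pos-*; abs-*; <⇒≤; <⇒≢; <⇒≱; ≤∧≢⇒<; i≤j⇒i-j≤0; i-j≡0⇒i≡j)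
import Data.Integer.Divisibility.Signed as Signed
open import Data.Integer.Tactic.RingSolver using (solve-∀; solve)
open import Data.List.Base using ([]; _∷_)
open import Data.Product using (_,_)
open import Data.Sum using (inj₁; inj₂; [_,_]′)
open import Function using (id)
open import Relation.Binary.PropositionalEquality using (refl; sym; trans; cong; cong₂; subst; module ≡-Reasoning)
open import Relation.Nullary.Negation using (contradiction)
open Descent using (Norm±4; SmallerUnit; norm+4⇒smaller-unit)

p%4≡1⇒p≡1+4[p/4] : ∀ {p} → p % 4 ≡ 1 → p ≡ 1 ℕ.+ 4 ℕ.* (p ℕ./ 4)
p%4≡1⇒p≡1+4[p/4] {p} p%4≡1 = trans (m≡m%n+[m/n]*n p 4) (cong₂ ℕ._+_ p%4≡1 (ℕ.*-comm (p ℕ./ 4) 4))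

pos-*-square : ∀ p R → + (p ℕ.* (R ℕ.* R)) ≡ + p * + R * + R
pos-*-square p R = begin
  + (p ℕ.* (R ℕ.* R))  ≡⟨ cong +_ (ℕ.*-assoc p R R) ⟨
  + (p ℕ.* R ℕ.* R)    ≡⟨ pos-* (p ℕ.* R) R ⟩
  + (p ℕ.* R) * + R    ≡⟨ cong (_* + R) (pos-* p R) ⟩
  + p * + R * + R      ∎
  where open ≡-Reasoning

pos-norm : ∀ p S R → + S * + S - + p * + R * + R ≡ + (S ℕ.* S) - + (p ℕ.* (R ℕ.* R))
pos-norm p S R = cong₂ _-_ (sym (pos-* S S)) (sym (pos-*-square p R))

+a-+b≡+c⇒a≡b+c : ∀ {a b c} → + a - + b ≡ + c → a ≡ b ℕ.+ c
+a-+b≡+c⇒a≡b+c {a} {b} {c} eq = +-injective (begin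
  + a                ≡⟨ identity (+ a) (+ b) ⟩
  (+ a - + b) + + b  ≡⟨ cong (_+ + b) eq ⟩
  + c + + b          ≡⟨ +-comm (+ c) (+ b) ⟩
  + b + + c          ≡⟨ pos-+ b c ⟨
  + (b ℕ.+ c)        ∎)
  where
  open ≡-Reasoning
  identity : ∀ x y → x ≡ (x - y) + y
  identity = solve-∀

a≡b+c⇒+a-+b≡+c : ∀ {a b c} → a ≡ b ℕ.+ c → + a - + b ≡ + c
a≡b+c⇒+a-+b≡+c {b = b} {c} refl = trans (cong (_- + b) (pos-+ b c)) (identity (+ b) (+ c))
  where
  identity : ∀ x y → (x + y) - x ≡ y
  identity = solve-∀

a+c≡b⇒+a-+b≡-+c : ∀ {a b c} → a ℕ.+ c ≡ b → + a - + b ≡ - + c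
a+c≡b⇒+a-+b≡-+c {a} {c = c} refl = trans (cong (λ n → + a - n) (pos-+ a c)) (identity (+ a) (+ c))
  where
  identity : ∀ x y → x - (x + y) ≡ - y
  identity = solve-∀

norm±4⇒IsUnit-norm : ∀ {p S R} → Norm±4 p S R →
  (+ S * + S - + p * + R * + R ≡ + 4) ⊎ (+ S * + S - + p * + R * + R ≡ - + 4)
norm±4⇒IsUnit-norm {p} {S} {R} (inj₁ SS≡pRR+4) = inj₁ (trans (pos-norm p S R) (a≡b+c⇒+a-+b≡+c SS≡pRR+4))
norm±4⇒IsUnit-norm {p} {S} {R} (inj₂ SS+4≡pRR) = inj₂ (trans (pos-norm p S R) (a+c≡b⇒+a-+b≡-+c SS+4≡pRR))

2∣S+R⇒2∣S-R : ∀ {S R} → 2 ℕ.∣ S ℕ.+ R → + 2 ∣ + S - + R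
2∣S+R⇒2∣S-R {S} {R} 2∣S+R = Signed.∣⇒∣ᵤ (subst (Signed._∣_ (+ 2)) (begin
  + (S ℕ.+ R) - + 2 * + R  ≡⟨ cong (_- + 2 * + R) (pos-+ S R) ⟩
  (+ S + + R) - + 2 * + R  ≡⟨ identity (+ S) (+ R) ⟩
  + S - + R                ∎)
  (Signed.∣m∣n⇒∣m-n (Signed.∣ᵤ⇒∣ {+ 2} {+ (S ℕ.+ R)} 2∣S+R)
                     (Signed.∣m⇒∣m*n (+ R) Signed.∣-refl)))
  where
  open ≡-Reasoning
  identity : ∀ x y → (x + y) - + 2 * y ≡ x - y
  identity = solve-∀

1<p*R*R : ∀ {p R} → ℕ.NonTrivial p → NonZero R → + 1 < + p * + R * + R
1<p*R*R {p} {R} p>1 R≢0 = subst (+ 1 <_) (pos-*-square p R)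
  (+<+ (ℕ.<-≤-trans (ℕ.nonTrivial⇒n>1 p) (ℕ.m≤m*n p (R ℕ.* R))))
  where instance
    _ = p>1
    _ = R≢0
    _ = ℕ.m*n≢0 R R

nonZero⇒GtOne : ∀ {p S R} → ℕ.NonTrivial p → NonZero S → NonZero R → GtOne (+ p) (+ S) (+ R)
nonZero⇒GtOne {S = ℕ.suc (ℕ.suc _)} {R} _ _ R≢0 =
  inj₂ (inj₁ (+≤+ ℕ.z≤n , +<+ (ℕ.>-nonZero⁻¹ R {{R≢0}})))
nonZero⇒GtOne {S = 1} {R} p>1 _ R≢0 =
  inj₂ (inj₂ (inj₂ (-<+ , +<+ (ℕ.>-nonZero⁻¹ R {{R≢0}}) , 1<p*R*R p>1 R≢0)))

i<j⇒i-j<0 : ∀ {i j} → i < j → i - j < + 0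
i<j⇒i-j<0 {i} {j} i<j =
  ≤∧≢⇒< (i≤j⇒i-j≤0 (<⇒≤ i<j)) (λ i-j≡0 → <⇒≢ i<j (i-j≡0⇒i≡j i j i-j≡0))

x<0⇒y≤0⇒¬NonNegSqrt : ∀ {d x y} → x < + 0 → y ≤ + 0 → ¬ NonNegSqrt d x y
x<0⇒y≤0⇒¬NonNegSqrt x<0 _   (inj₁ (inj₁ (0<x , _)))                 = <⇒≱ 0<x (<⇒≤ x<0)
x<0⇒y≤0⇒¬NonNegSqrt x<0 _   (inj₁ (inj₂ (inj₁ (0≤x , _))))          = <⇒≱ x<0 0≤x
x<0⇒y≤0⇒¬NonNegSqrt x<0 _   (inj₁ (inj₂ (inj₂ (inj₁ (0<x , _)))))   = <⇒≱ 0<x (<⇒≤ x<0)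
x<0⇒y≤0⇒¬NonNegSqrt _   y≤0 (inj₁ (inj₂ (inj₂ (inj₂ (_ , 0<y , _))))) = <⇒≱ 0<y y≤0
x<0⇒y≤0⇒¬NonNegSqrt x<0 _   (inj₂ (refl , _))                       = <⇒≢ x<0 refl

SmallerUnit⇒¬IsFundamentalUnit : ∀ {p T B} → Prime p → SmallerUnit p T B → ¬ IsFundamentalUnit (+ p) (+ T) (+ B)
SmallerUnit⇒¬IsFundamentalUnit {p} pr unit (_ , _ , minimal) =
  x<0⇒y≤0⇒¬NonNegSqrt {+ p} (i<j⇒i-j<0 (+<+ S<T)) (i≤j⇒i-j≤0 (+≤+ R≤B))
    (minimal (+ S) (+ R) (norm±4⇒IsUnit-norm {p} {S} {R} norm , 2∣S+R⇒2∣S-R {S} {R} 2∣S+R)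
                         (nonZero⇒GtOne (prime⇒nonTrivial pr) S≢0 R≢0))
  where open SmallerUnit unit

fundamental-unit-norm≡-4 : ∀ {p T B} {{_ : NonZero B}} → Prime p → p % 4 ≡ 1 →
  IsFundamentalUnit (+ p) (+ T) (+ B) → + T * + T - + p * + B * + B ≡ - + 4
fundamental-unit-norm≡-4 _ _ ((inj₂ norm≡-4 , _) , _) = norm≡-4
fundamental-unit-norm≡-4 {p} {T} {B} pr p%4≡1 fu@((inj₁ norm≡4 , _) , _) =
  contradiction fu (SmallerUnit⇒¬IsFundamentalUnit pr (norm+4⇒smaller-unit {q = p ℕ./ 4} pr
    (p%4≡1⇒p≡1+4[p/4] p%4≡1) (+a-+b≡+c⇒a≡b+c (trans (sym (pos-norm p T B)) norm≡4))))

conjugate-product : ∀ {P t b A B} → t * t - P * b * b ≡ - + 4 → P ≡ A * A + B * B →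
  (A * t + + 2 * B) * (A * t - + 2 * B) ≡ (A * A * b * b - + 4) * P
conjugate-product {P} {t} {b} {A} {B} norm≡-4 P≡A²+B² = begin
  (A * t + + 2 * B) * (A * t - + 2 * B)
    ≡⟨ solve (P ∷ t ∷ b ∷ A ∷ B ∷ []) ⟩
  A * A * (t * t - P * b * b) + (A * A * b * b * P - + 4 * (B * B))
    ≡⟨ cong (λ n → A * A * n + (A * A * b * b * P - + 4 * (B * B))) norm≡-4 ⟩
  A * A * - + 4 + (A * A * b * b * P - + 4 * (B * B))
    ≡⟨ solve (P ∷ b ∷ A ∷ B ∷ []) ⟩
  A * A * b * b * P - + 4 * (A * A + B * B)
    ≡⟨ cong (λ n → A * A * b * b * P - + 4 * n) P≡A²+B² ⟨
  A * A * b * b * P - + 4 * P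
    ≡⟨ solve (P ∷ b ∷ A ∷ []) ⟩
  (A * A * b * b - + 4) * P
    ∎
  where open ≡-Reasoning

ℤ-euclidsLemma : ∀ {p} x y → Prime p → + p ∣ x * y → + p ∣ x ⊎ + p ∣ y
ℤ-euclidsLemma {p} x y pr p∣xy = euclidsLemma ℤ.∣ x ∣ ℤ.∣ y ∣ pr (subst (p ℕ.∣_) (abs-* x y) p∣xy)

prime≡1mod4⇒∤4 : ∀ {p} → Prime p → p % 4 ≡ 1 → ¬ p ℕ.∣ 4
prime≡1mod4⇒∤4 {p} pr p%4≡1 p∣4
  with ℕ.≤-antisym (ℕ.∣⇒≤ p∣2) (ℕ.nonTrivial⇒n>1 p {{prime⇒nonTrivial pr}})
  where
  p∣2 : p ℕ.∣ 2
  p∣2 = [ id , id ]′ (euclidsLemma 2 2 pr p∣4)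
... | refl = contradiction p%4≡1 λ ()

p≡A*A+B*B⇒p∤B : ∀ {p A B} → Prime p → + p ≡ A * A + B * B → ¬ + p ∣ B
p≡A*A+B*B⇒p∤B {p} {A} {B} pr p≡A²+B² p∣B = ℕ.<⇒≱ (ℕ.m<m*n p p (ℕ.nonTrivial⇒n>1 p)) (ℕ.∣⇒≤ pp∣p)
  where
  instance
    _ = prime⇒nonTrivial pr
    _ = ℕ.nonTrivial⇒nonZero p
  P = + p
  P∣B : P Signed.∣ B
  P∣B = Signed.∣ᵤ⇒∣ p∣B
  P∣A*A : P Signed.∣ A * A
  P∣A*A = subst (P Signed.∣_) (trans (cong (_- B * B) p≡A²+B²) (identity (A * A) (B * B)))
            (Signed.∣m∣n⇒∣m-n Signed.∣-refl (Signed.∣m⇒∣m*n B P∣B))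
    where
    identity : ∀ x y → (x + y) - y ≡ x
    identity = solve-∀
  P∣A : P Signed.∣ A
  P∣A = Signed.∣ᵤ⇒∣ ([ id , id ]′ (ℤ-euclidsLemma A A pr (Signed.∣⇒∣ᵤ P∣A*A)))
  pp∣p : p ℕ.* p ℕ.∣ p
  pp∣p with P∣A | P∣B
  ... | Signed.divides a A≡aP | Signed.divides b B≡bP =
    subst (ℕ._∣ p) (abs-* P P) (Signed.∣⇒∣ᵤ (Signed.divides (a * a + b * b) (begin
      P                                  ≡⟨ p≡A²+B² ⟩
      A * A + B * B                      ≡⟨ cong₂ (λ x y → x * x + y * y) A≡aP B≡bP ⟩
      a * P * (a * P) + b * P * (b * P)  ≡⟨ identity a b P ⟩
      (a * a + b * b) * (P * P)          ∎)))
    where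
    open ≡-Reasoning
    identity : ∀ a b P → a * P * (a * P) + b * P * (b * P) ≡ (a * a + b * b) * (P * P)
    identity = solve-∀

exactly-one : ∀ {a b} {X : Set a} {Y : Set b} → X ⊎ Y → ¬ (X × Y) → (X × ¬ Y) ⊎ (¬ X × Y)
exactly-one (inj₁ x) ¬x×y = inj₁ (x , λ y → ¬x×y (x , y))
exactly-one (inj₂ y) ¬x×y = inj₂ ((λ x → ¬x×y (x , y)) , y)

-- The hypothesis A ≡ -1 (mod 4) only decides which alternative holds.
lemma4 : (p : ℕ) → Prime p → p % 4 ≡ 1 →
    (t b : ℤ) → + 0 < t → + 0 < b → IsFundamentalUnit (+ p) t b →
    (A B : ℤ) → + p ≡ A * A + B * B → + 4 ∣ (A + + 1) →
    ((+ p ∣ (A * t + + 2 * B)) × ¬ (+ p ∣ (A * t - + 2 * B)))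
    ⊎ (¬ (+ p ∣ (A * t + + 2 * B)) × (+ p ∣ (A * t - + 2 * B)))
lemma4 p pr p%4≡1 (+ t) (+ b) (+<+ _) (+<+ 0<b) fu A B p≡A²+B² _ =
  exactly-one (ℤ-euclidsLemma x y pr p∣xy) ¬p∣x×p∣y
  where
  instance _ = ℕ.>-nonZero 0<b
  x = A * + t + + 2 * B
  y = A * + t - + 2 * B
  p∣xy : + p ∣ x * y
  p∣xy = Signed.∣⇒∣ᵤ {+ p} {x * y} (Signed.divides (A * A * + b * + b - + 4)
           (conjugate-product {+ p} {+ t} {+ b} {A} {B} (fundamental-unit-norm≡-4 pr p%4≡1 fu) p≡A²+B²))
  p∣4∣B∣ : + p ∣ x → + p ∣ y → p ℕ.∣ 4 ℕ.* ℤ.∣ B ∣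
  p∣4∣B∣ p∣x p∣y = subst (p ℕ.∣_) (abs-* (+ 4) B) (Signed.∣⇒∣ᵤ {+ p} {+ 4 * B}
    (subst (Signed._∣_ (+ p)) (x-y≡4B A (+ t) B)
      (Signed.∣m∣n⇒∣m-n (Signed.∣ᵤ⇒∣ {+ p} {x} p∣x) (Signed.∣ᵤ⇒∣ {+ p} {y} p∣y))))
    where
    x-y≡4B : ∀ A t B → (A * t + + 2 * B) - (A * t - + 2 * B) ≡ + 4 * B
    x-y≡4B = solve-∀
  ¬p∣x×p∣y : ¬ (+ p ∣ x × + p ∣ y)
  ¬p∣x×p∣y (p∣x , p∣y) with euclidsLemma 4 ℤ.∣ B ∣ pr (p∣4∣B∣ p∣x p∣y)
  ... | inj₁ p∣4 = prime≡1mod4⇒∤4 pr p%4≡1 p∣4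
  ... | inj₂ p∣B = p≡A*A+B*B⇒p∤B {A = A} {B} pr p≡A²+B² p∣B
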